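{- Let $\sigma$ be a chip configuration on $K_n$ and fix $j\in[n]$. For all $t\ge0$: for $v\le j$, $u_t(\sigma,v)-1\le u_t(c^j\sigma,v)\le u_t(\sigma,v)$; and for $v>j$, $u_t(\sigma,v)\le u_t(c^j\sigma,v)\le u_t(\sigma,v)+1$.
   Context: Parallel chip-firing on $K_n$: for an integer-valued $\sigma:[n]\to\mathbb{Z}$, $r(\sigma)=\#\{v:\sigma(v)\ge n\}$, $U\sigma(v)=\sigma(v)+r(\sigma)$ if $\sigma(v)\le n-1$, $U\sigma(v)=\sigma(v)-n+r(\sigma)$ if $\sigma(v)\ge n$, and $u_t(\sigma,v)=\#\{0\le s<t:U^s\sigma(v)\ge n\}$. The conjugate configuration is $c^j\sigma(v)=\sigma(v)+j-n$ for $v\le j$ and $c^j\sigma(v)=\sigma(v)+j$ for $v>j$ (the same update rule is applied to it). -}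

module Defs where

open import Data.Nat as ℕ using (ℕ; zero; suc)
open import Data.Integer as ℤ using (ℤ; +_; _+_; _-_; _≤ᵇ_)
open import Data.Fin using (Fin; toℕ)
open import Data.Fin.Properties using ()
open import Data.List using (List; length; filter)
open import Data.List.Base using (allFin)
open import Data.Bool using (Bool; true; false; if_then_else_)
open import Relation.Nullary using (yes; no)
open import Data.Integer.Properties using ()

-- A chip configuration on K_n: vertices [n] = {1,…,n} encoded by Fin n
-- (vertex i+1 ↔ index i), integer-valued.
Config : ℕ → Set
Config n = Fin n → ℤ

fires : ∀ n → ℤ → Bool
fires n x = (+ n) ≤ᵇ x

countFiring : ∀ {n} → (Fin n → Bool) → ℕ
countFiring {zero} f = 0
countFiring {suc n} f = (if f Fin.zero then 1 else 0) ℕ.+ countFiring (λ i → f (Fin.suc i))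
  where import Data.Fin as Fin

r : ∀ {n} → Config n → ℕ
r {n} σ = countFiring (λ v → fires n (σ v))

U : ∀ {n} → Config n → Config n
U {n} σ v =
  if fires n (σ v) then σ v - (+ n) + (+ r σ) else σ v + (+ r σ)

iter : ∀ {n} → ℕ → Config n → Config n
iter zero σ = σ
iter (suc s) σ = U (iter s σ)

u : ∀ {n} → ℕ → Config n → Fin n → ℕ
u zero σ v = 0
u {n} (suc t) σ v = u t σ v ℕ.+ (if fires n (iter t σ v) then 1 else 0)

-- conjugate configuration c^j σ, for j ∈ [n] given as a natural number:
-- vertex v (index i, v = i+1) gets σ(v)+j-n if v ≤ j, else σ(v)+j.
conj : ∀ {n} → ℕ → Config n → Config n
conj {n} j σ i with suc (toℕ i) ℕ.≤? j
... | yes _ = σ i + (+ j) - (+ n)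
... | no _ = σ i + (+ j)

-- Chips are conserved up to firing: U^t σ(v) + n·u_t(σ,v) = σ(v) + Σ_w u_t(σ,w),
-- and likewise for c^j σ, which starts from σ(v) + j − n·[v ≤ j]. Put
-- S_t(v) = u_t(c^j σ,v) + [v ≤ j]; then Σ_w S_t(w) = Σ_w u_t(c^j σ,w) + j and
-- U^t c^j σ(v) − U^t σ(v) = Σ_w (S_t − u_t(σ,·))(w) − n·(S_t(v) − u_t(σ,v)).
-- Inductively S_t(v) is u_t(σ,v) or u_t(σ,v) + 1 at every vertex, so the sum
-- lies in [0, n]: where S_t(v) = u_t(σ,v) the vertex is at least as loaded in
-- c^j σ as in σ, hence fires there whenever it fires in σ, and where
-- S_t(v) = u_t(σ,v) + 1 the reverse holds. Either way the invariant survives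
-- one more step.
module Submission where

open import Defs
open import Data.Nat using (ℕ; suc; _≤_; _<_; _+_)
open import Data.Fin using (Fin; toℕ)
open import Data.Product using (_×_)

import Algebra.Properties.CommutativeMonoid.Sum as Sum
import Algebra.Properties.CommutativeSemigroup
open import Data.Bool using (Bool; true; false; if_then_else_; T)
open import Data.Empty using (⊥-elim)
open import Data.Fin as Fin using ()
open import Data.Integer as ℤ using (ℤ; +_; _-_)
import Data.Integer.Properties as ℤ
open import Data.Integer.Tactic.RingSolver using (solve-∀)
open import Data.Nat as ℕ using (zero; _*_; z≤n; s≤s; _≤?_)
import Data.Nat.Properties as ℕ
open import Data.Product using (_,_; proj₁; proj₂)
open import Data.Sum using (_⊎_; inj₁; inj₂)
open import Function using (_∘_)
open import Relation.Nullary using (yes; no)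
open import Relation.Binary.PropositionalEquality

module ℕ+ = Algebra.Properties.CommutativeSemigroup ℕ.+-commutativeSemigroup
module ℤ+ = Algebra.Properties.CommutativeSemigroup ℤ.+-commutativeSemigroup
open Sum ℕ.+-0-commutativeMonoid using (sum; sum-cong-≗; ∑-distrib-+; sum-replicate-zero)

sum-mono-≤ : ∀ {n} {f g : Fin n → ℕ} → (∀ i → f i ≤ g i) → sum f ≤ sum g
sum-mono-≤ {zero}  f≤g = z≤n
sum-mono-≤ {suc n} f≤g = ℕ.+-mono-≤ (f≤g Fin.zero) (sum-mono-≤ (f≤g ∘ Fin.suc))

sum-const-1 : ∀ n → sum {n} (λ _ → 1) ≡ n
sum-const-1 zero    = refl
sum-const-1 (suc n) = cong suc (sum-const-1 n)

countFiring≡sum : ∀ {n} (f : Fin n → Bool) →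
                  countFiring f ≡ sum (λ i → if f i then 1 else 0)
countFiring≡sum {zero}  f = refl
countFiring≡sum {suc n} f =
  cong ((if f Fin.zero then 1 else 0) ℕ.+_) (countFiring≡sum (f ∘ Fin.suc))

EqOrSuc : ℕ → ℕ → Set
EqOrSuc a x = x ≡ a ⊎ x ≡ suc a

eqOrSuc⇒≤ : ∀ {a x} → EqOrSuc a x → a ≤ x
eqOrSuc⇒≤ {a} (inj₁ refl) = ℕ.≤-refl
eqOrSuc⇒≤ {a} (inj₂ refl) = ℕ.n≤1+n a

eqOrSuc⇒≤+1 : ∀ {a x} → EqOrSuc a x → x ≤ a + 1
eqOrSuc⇒≤+1 {a} (inj₁ refl) = ℕ.m≤m+n a 1
eqOrSuc⇒≤+1 {a} (inj₂ refl) = ℕ.≤-reflexive (ℕ.+-comm 1 a)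

eqOrSuc-+-≤ : ∀ a {p q} → p ≤ q → q ≤ 1 → EqOrSuc (a + p) (a + q)
eqOrSuc-+-≤ a z≤n       z≤n       = inj₁ refl
eqOrSuc-+-≤ a z≤n       (s≤s z≤n) = inj₂ (ℕ.+-suc a 0)
eqOrSuc-+-≤ a (s≤s z≤n) (s≤s z≤n) = inj₁ refl

eqOrSuc-suc-+-≥ : ∀ a {p q} → q ≤ p → p ≤ 1 → EqOrSuc (a + p) (suc a + q)
eqOrSuc-suc-+-≥ a z≤n       z≤n       = inj₂ refl
eqOrSuc-suc-+-≥ a z≤n       (s≤s z≤n) = inj₁ (sym (ℕ.+-suc a 0))
eqOrSuc-suc-+-≥ a (s≤s z≤n) (s≤s z≤n) = inj₂ refl

eqOrSuc-step : ∀ {a x p q} → EqOrSuc a x → (x ≡ a → p ≤ q) → (x ≡ suc a → q ≤ p) →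
               p ≤ 1 → q ≤ 1 → EqOrSuc (a + p) (x + q)
eqOrSuc-step {a} (inj₁ refl) level _     _   q≤1 = eqOrSuc-+-≤ a (level refl) q≤1
eqOrSuc-step {a} (inj₂ refl) _     ahead p≤1 _   = eqOrSuc-suc-+-≥ a (ahead refl) p≤1

sum-eqOrSuc : ∀ {n} {f g : Fin n → ℕ} → (∀ i → EqOrSuc (f i) (g i)) →
              sum f ≤ sum g × sum g ≤ sum f + n
sum-eqOrSuc {n} {f} {g} f~g = sum-mono-≤ (eqOrSuc⇒≤ ∘ f~g) , (begin
  sum g                       ≤⟨ sum-mono-≤ (eqOrSuc⇒≤+1 ∘ f~g) ⟩
  sum (λ i → f i + 1)         ≡⟨ ∑-distrib-+ f (λ _ → 1) ⟩
  sum f + sum {n} (λ _ → 1)   ≡⟨ cong (sum f ℕ.+_) (sum-const-1 n) ⟩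
  sum f + n                   ∎)
  where open ℕ.≤-Reasoning

≤-by-offsets : ∀ {x y w : ℤ} {k p q : ℕ} →
               x ℤ.+ + k ≡ w ℤ.+ + p → y ℤ.+ + k ≡ w ℤ.+ + q → p ≤ q → x ℤ.≤ y
≤-by-offsets {x} {y} {w} {k} {p} {q} x+k≡w+p y+k≡w+q p≤q =
  subst₂ ℤ._≤_ (cancel x (+ k)) (cancel y (+ k)) (ℤ.+-monoˡ-≤ (ℤ.- + k) (begin
    x ℤ.+ + k   ≡⟨ x+k≡w+p ⟩
    w ℤ.+ + p   ≤⟨ ℤ.+-monoʳ-≤ w (ℤ.+≤+ p≤q) ⟩
    w ℤ.+ + q   ≡⟨ y+k≡w+q ⟨
    y ℤ.+ + k   ∎))
  where
  open ℤ.≤-Reasoning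
  cancel : ∀ a b → a ℤ.+ b - b ≡ a
  cancel = solve-∀

firing : ℕ → ℤ → ℕ
firing n x = if fires n x then 1 else 0

firing≤1 : ∀ n x → firing n x ≤ 1
firing≤1 n x with fires n x
... | true  = ℕ.≤-refl
... | false = z≤n

firing-mono : ∀ n {x y} → x ℤ.≤ y → firing n x ≤ firing n y
firing-mono n {x} {y} x≤y with fires n x in x-fires | fires n y in y-fires
... | false | _     = z≤n
... | true  | true  = ℕ.≤-refl
... | true  | false = ⊥-elim (subst T y-fires (ℤ.≤⇒≤ᵇ n≤y))
  where
  n≤y : + n ℤ.≤ y
  n≤y = ℤ.≤-trans (ℤ.≤ᵇ⇒≤ (subst T (sym x-fires) _)) x≤y

U-+-firing : ∀ {n} (σ : Config n) v →
             U σ v ℤ.+ + (n * firing n (σ v)) ≡ σ v ℤ.+ + r σ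
U-+-firing {n} σ v with fires n (σ v)
... | true  = begin
  σ v - + n ℤ.+ + r σ ℤ.+ + (n * 1) ≡⟨ cong (λ k → σ v - + n ℤ.+ + r σ ℤ.+ + k) (ℕ.*-identityʳ n) ⟩
  σ v - + n ℤ.+ + r σ ℤ.+ + n       ≡⟨ cancel (σ v) (+ n) (+ r σ) ⟩
  σ v ℤ.+ + r σ                     ∎
  where
  open ≡-Reasoning
  cancel : ∀ a b c → a - b ℤ.+ c ℤ.+ b ≡ a ℤ.+ c
  cancel = solve-∀
... | false = begin
  σ v ℤ.+ + r σ ℤ.+ + (n * 0) ≡⟨ cong (λ k → σ v ℤ.+ + r σ ℤ.+ + k) (ℕ.*-zeroʳ n) ⟩
  σ v ℤ.+ + r σ ℤ.+ + 0       ≡⟨ ℤ.+-identityʳ _ ⟩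
  σ v ℤ.+ + r σ               ∎
  where open ≡-Reasoning

sum-u-suc : ∀ {n} (σ : Config n) t → sum (u (suc t) σ) ≡ sum (u t σ) + r (iter t σ)
sum-u-suc {n} σ t = begin
  sum (λ w → u t σ w + firing n (iter t σ w))         ≡⟨ ∑-distrib-+ (u t σ) (λ w → firing n (iter t σ w)) ⟩
  sum (u t σ) + sum (λ w → firing n (iter t σ w))     ≡⟨ cong (sum (u t σ) ℕ.+_) (sym (countFiring≡sum (λ w → fires n (iter t σ w)))) ⟩
  sum (u t σ) + r (iter t σ)                           ∎
  where open ≡-Reasoning

iter-+-u : ∀ {n} (σ : Config n) t v →
           iter t σ v ℤ.+ + (n * u t σ v) ≡ σ v ℤ.+ + sum (u t σ)
iter-+-u {n} σ zero v =
  cong (λ k → σ v ℤ.+ + k) (trans (ℕ.*-zeroʳ n) (sym (sum-replicate-zero n)))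
iter-+-u {n} σ (suc t) v = begin
  U ρ v ℤ.+ + (n * (A + f))                  ≡⟨ cong (λ k → U ρ v ℤ.+ + k) (ℕ.*-distribˡ-+ n A f) ⟩
  U ρ v ℤ.+ (+ (n * A) ℤ.+ + (n * f))        ≡⟨ ℤ+.x∙yz≈xz∙y (U ρ v) (+ (n * A)) (+ (n * f)) ⟩
  U ρ v ℤ.+ + (n * f) ℤ.+ + (n * A)          ≡⟨ cong (ℤ._+ + (n * A)) (U-+-firing ρ v) ⟩
  ρ v ℤ.+ + r ρ ℤ.+ + (n * A)                ≡⟨ ℤ+.xy∙z≈xz∙y (ρ v) (+ r ρ) (+ (n * A)) ⟩
  ρ v ℤ.+ + (n * A) ℤ.+ + r ρ                ≡⟨ cong (ℤ._+ + r ρ) (iter-+-u σ t v) ⟩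
  σ v ℤ.+ + sum (u t σ) ℤ.+ + r ρ            ≡⟨ ℤ.+-assoc (σ v) _ _ ⟩
  σ v ℤ.+ + (sum (u t σ) + r ρ)              ≡⟨ cong (λ k → σ v ℤ.+ + k) (sym (sum-u-suc σ t)) ⟩
  σ v ℤ.+ + sum (u (suc t) σ)                ∎
  where
  open ≡-Reasoning
  ρ : Config n
  ρ = iter t σ
  A f : ℕ
  A = u t σ v
  f = firing n (ρ v)

iter-+-u-suc : ∀ {n} (σ : Config n) t v →
               iter t σ v ℤ.+ + (n * suc (u t σ v)) ≡ σ v ℤ.+ + (sum (u t σ) + n)
iter-+-u-suc {n} σ t v = begin
  iter t σ v ℤ.+ + (n * suc A)          ≡⟨ cong (λ k → iter t σ v ℤ.+ + k) (ℕ.*-suc n A) ⟩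
  iter t σ v ℤ.+ (+ n ℤ.+ + (n * A))    ≡⟨ ℤ+.x∙yz≈xz∙y (iter t σ v) (+ n) (+ (n * A)) ⟩
  iter t σ v ℤ.+ + (n * A) ℤ.+ + n      ≡⟨ cong (ℤ._+ + n) (iter-+-u σ t v) ⟩
  σ v ℤ.+ + sum (u t σ) ℤ.+ + n         ≡⟨ ℤ.+-assoc (σ v) _ _ ⟩
  σ v ℤ.+ + (sum (u t σ) + n)           ∎
  where
  open ≡-Reasoning
  A : ℕ
  A = u t σ v

-- [v ≤ j] for the vertex v = toℕ i + 1.
inPrefix : ∀ {n} → ℕ → Fin n → ℕ
inPrefix j i with suc (toℕ i) ≤? j
... | yes _ = 1
... | no  _ = 0

inPrefix-≤ : ∀ {n} {j} {i : Fin n} → suc (toℕ i) ≤ j → inPrefix j i ≡ 1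
inPrefix-≤ {j = j} {i} i<j with suc (toℕ i) ≤? j
... | yes _   = refl
... | no  i≮j = ⊥-elim (i≮j i<j)

inPrefix-> : ∀ {n} {j} {i : Fin n} → j < suc (toℕ i) → inPrefix j i ≡ 0
inPrefix-> {j = j} {i} j≤i with suc (toℕ i) ≤? j
... | yes i<j = ⊥-elim (ℕ.<⇒≱ j≤i i<j)
... | no  _   = refl

inPrefix-eqOrSuc : ∀ {n} j (i : Fin n) → EqOrSuc 0 (inPrefix j i)
inPrefix-eqOrSuc j i with suc (toℕ i) ≤? j
... | yes _ = inj₂ refl
... | no  _ = inj₁ refl

inPrefix-suc : ∀ {n} j (i : Fin n) → inPrefix (suc j) (Fin.suc i) ≡ inPrefix j i
inPrefix-suc j i with suc (toℕ i) ≤? j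
... | yes i<j = inPrefix-≤ (s≤s i<j)
... | no  i≮j = inPrefix-> (s≤s (ℕ.≰⇒> i≮j))

sum-inPrefix : ∀ {n j} → j ≤ n → sum {n} (inPrefix j) ≡ j
sum-inPrefix {n} {zero} _ =
  trans (sum-cong-≗ (λ i → inPrefix-> {n} {i = i} (s≤s z≤n))) (sum-replicate-zero n)
sum-inPrefix {suc n} {suc j} (s≤s j≤n) =
  cong₂ _+_ (inPrefix-≤ {suc n} {suc j} {Fin.zero} (s≤s z≤n))
            (trans (sum-cong-≗ (inPrefix-suc {n} j)) (sum-inPrefix j≤n))

conj-+-inPrefix : ∀ {n} j (σ : Config n) i →
                  conj j σ i ℤ.+ + (n * inPrefix j i) ≡ σ i ℤ.+ + j
conj-+-inPrefix {n} j σ i with suc (toℕ i) ≤? j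
... | yes _ = trans (cong (λ k → σ i ℤ.+ + j - + n ℤ.+ + k) (ℕ.*-identityʳ n)) (cancel (σ i) (+ j) (+ n))
  where
  cancel : ∀ a b c → a ℤ.+ b - c ℤ.+ c ≡ a ℤ.+ b
  cancel = solve-∀
... | no  _ = trans (cong (λ k → σ i ℤ.+ + j ℤ.+ + k) (ℕ.*-zeroʳ n)) (ℤ.+-identityʳ _)

module Conjugate {n} (σ : Config n) (j : ℕ) (j≤n : j ≤ n) where

  τ : Config n
  τ = conj j σ

  shifted : ℕ → Fin n → ℕ
  shifted t v = u t τ v + inPrefix j v

  sum-shifted : ∀ t → sum (shifted t) ≡ sum (u t τ) + j
  sum-shifted t = trans (∑-distrib-+ (u t τ) (inPrefix j)) (cong (sum (u t τ) ℕ.+_) (sum-inPrefix j≤n))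

  iter-+-shifted : ∀ t v → iter t τ v ℤ.+ + (n * shifted t v) ≡ σ v ℤ.+ + sum (shifted t)
  iter-+-shifted t v = begin
    iter t τ v ℤ.+ + (n * (B + I))                ≡⟨ cong (λ k → iter t τ v ℤ.+ + k) (ℕ.*-distribˡ-+ n B I) ⟩
    iter t τ v ℤ.+ (+ (n * B) ℤ.+ + (n * I))      ≡⟨ ℤ.+-assoc (iter t τ v) _ _ ⟨
    iter t τ v ℤ.+ + (n * B) ℤ.+ + (n * I)        ≡⟨ cong (ℤ._+ + (n * I)) (iter-+-u τ t v) ⟩
    τ v ℤ.+ + sum (u t τ) ℤ.+ + (n * I)           ≡⟨ ℤ+.xy∙z≈xz∙y (τ v) _ _ ⟩
    τ v ℤ.+ + (n * I) ℤ.+ + sum (u t τ)           ≡⟨ cong (ℤ._+ + sum (u t τ)) (conj-+-inPrefix j σ v) ⟩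
    σ v ℤ.+ + j ℤ.+ + sum (u t τ)                 ≡⟨ ℤ+.xy∙z≈x∙zy (σ v) _ _ ⟩
    σ v ℤ.+ + (sum (u t τ) + j)                   ≡⟨ cong (λ k → σ v ℤ.+ + k) (sum-shifted t) ⟨
    σ v ℤ.+ + sum (shifted t)                     ∎
    where
    open ≡-Reasoning
    B I : ℕ
    B = u t τ v
    I = inPrefix j v

  iter-+-n*-shifted : ∀ {t v k} → shifted t v ≡ k →
                      iter t τ v ℤ.+ + (n * k) ≡ σ v ℤ.+ + sum (shifted t)
  iter-+-n*-shifted {t} {v} refl = iter-+-shifted t v

  iter-≤-iter-conj : ∀ {t v} → shifted t v ≡ u t σ v → sum (u t σ) ≤ sum (shifted t) →
                     iter t σ v ℤ.≤ iter t τ v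
  iter-≤-iter-conj {t} {v} level sums-≤ =
    ≤-by-offsets {w = σ v} (iter-+-u σ t v) (iter-+-n*-shifted {t} level) sums-≤

  iter-conj-≤-iter : ∀ {t v} → shifted t v ≡ suc (u t σ v) → sum (shifted t) ≤ sum (u t σ) + n →
                     iter t τ v ℤ.≤ iter t σ v
  iter-conj-≤-iter {t} {v} ahead sums-≤ =
    ≤-by-offsets {w = σ v} (iter-+-n*-shifted {t} ahead) (iter-+-u-suc σ t v) sums-≤

  eqOrSuc-shifted : ∀ t v → EqOrSuc (u t σ v) (shifted t v)
  eqOrSuc-shifted zero    v = inPrefix-eqOrSuc j v
  eqOrSuc-shifted (suc t) v =
    subst (EqOrSuc (u (suc t) σ v)) (ℕ+.xy∙z≈xz∙y (u t τ v) (inPrefix j v) _)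
      (eqOrSuc-step (eqOrSuc-shifted t v)
        (λ level → firing-mono n (iter-≤-iter-conj {t} level (proj₁ sums)))
        (λ ahead → firing-mono n (iter-conj-≤-iter {t} ahead (proj₂ sums)))
        (firing≤1 n (iter t σ v)) (firing≤1 n (iter t τ v)))
    where
    sums : sum (u t σ) ≤ sum (shifted t) × sum (shifted t) ≤ sum (u t σ) + n
    sums = sum-eqOrSuc (eqOrSuc-shifted t)

lemma4p10 : ∀ {n} (σ : Config n) (j : ℕ) → 1 ≤ j → j ≤ n → ∀ (t : ℕ) (v : Fin n) →
    (suc (toℕ v) ≤ j → (u t σ v ≤ u t (conj j σ) v + 1) × (u t (conj j σ) v ≤ u t σ v)) ×
    (j < suc (toℕ v) → (u t σ v ≤ u t (conj j σ) v) × (u t (conj j σ) v ≤ u t σ v + 1))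
lemma4p10 σ j _ j≤n t v = lower , upper
  where
  open Conjugate σ j j≤n
  A B : ℕ
  A = u t σ v
  B = u t τ v

  lower : suc (toℕ v) ≤ j → (A ≤ B + 1) × (B ≤ A)
  lower v≤j = eqOrSuc⇒≤ inv , ℕ.+-cancelʳ-≤ 1 B A (eqOrSuc⇒≤+1 inv)
    where
    inv : EqOrSuc A (B + 1)
    inv = subst (λ k → EqOrSuc A (B + k)) (inPrefix-≤ v≤j) (eqOrSuc-shifted t v)

  upper : j < suc (toℕ v) → (A ≤ B) × (B ≤ A + 1)
  upper j<v = eqOrSuc⇒≤ inv , eqOrSuc⇒≤+1 inv
    where
    inv : EqOrSuc A B
    inv = subst (EqOrSuc A) (trans (cong (B ℕ.+_) (inPrefix-> j<v)) (ℕ.+-identityʳ B)) (eqOrSuc-shifted t v)
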